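{- Let $(G,\beta)$ be an edge-labeled graph (in the setting described in the context) with vertices $v_1,\dots,v_n$, and let $(G_{red},\beta_{red})$ be the graph obtained from $(G,\beta)$ by successively taking reduced graphs associated to the vertices $v_n,v_{n-1},\dots,v_{i+1}$ (each step consisting of a vertex reduction followed by multiple edge reduction). Then the map $\psi:\hat R_G\to\hat R_{G_{red}}$, $\psi(f_{v_1},\dots,f_{v_n})=(f_{v_1},\dots,f_{v_i})$, is a surjective $\mathbb{Z}$-module homomorphism with kernel $\hat{\mathcal F}_{i+1}\cup\hat{\mathcal F}_{i+2}\cup\cdots\cup\hat{\mathcal F}_n\cup\{(0,\dots,0)\}$, where $\hat{\mathcal F}_j$ are the flow-up classes of $\hat R_G$.
   Context: Setting: $G$ is a finite connected simple graph. Each vertex $v$ is labeled by $M_v=m_v\mathbb{Z}$ ($m_v\in\mathbb{Z}$), each edge $e$ by $\mathbb{Z}/r_e\mathbb{Z}$ ($r_e\in\mathbb{Z}$). A spline is $f\in\prod_v M_v$ with $f_u-f_v\in r_e\mathbb{Z}$ for every edge $e=uv$; $\hat R_G$ is the $\mathbb{Z}$-module of splines. A $j$-th flow-up class is a spline $F$ with $f_{v_j}\neq0$ and $f_{v_s}=0$ for all $s<j$; $\hat{\mathcal F}_j$ is the set of these. $(a,b,\dots)$ denotes gcd and $[a,b,\dots]$ lcm. Reduced graph associated to a vertex $v$: (1) delete $v$ and its incident edges; each neighbor $w$ of $v$ is kept with vertex module replaced by $[m_w,(m_v,r_{vw})]\mathbb{Z}$; for each pair of distinct neighbors $w,w'$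 of $v$ add an edge $ww'$ labeled $(r_{vw},r_{vw'})$; (2) replace any set of parallel edges with labels $r_1,\dots,r_k$ by a single edge labeled $[r_1,\dots,r_k]$. -}

module Defs where

open import Data.Nat using (ℕ; zero; suc; _≤_; _<_)
open import Data.Integer using (ℤ; _-_; _+_; _*_; 0ℤ)
open import Data.Integer.Divisibility using (_∣_)
open import Data.Integer.GCD using (gcd)
open import Data.Integer.LCM using (lcm)
open import Data.Fin using (Fin; toℕ; inject₁; fromℕ; _≟_)
open import Data.Bool using (Bool; true; false; _∧_; _∨_; not; if_then_else_)
open import Relation.Nullary.Decidable using (⌊_⌋)
open import Relation.Binary.PropositionalEquality using (_≡_; _≢_)
open import Relation.Nullary using (¬_)
open import Data.Product using (Σ; _×_)

-- An edge-labeled graph on vertices v_1..v_n, represented as Fin n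
-- (v_{j+1} is the vertex with toℕ index j).
--   adj u v   : whether uv is an edge
--   label u v : r_{uv}, the edge label (Z / r_{uv} Z); only meaningful when adj u v
--   mod v     : m_v, the vertex module is m_v Z
record LGraph (n : ℕ) : Set where
  field
    adj   : Fin n → Fin n → Bool
    label : Fin n → Fin n → ℤ
    mod   : Fin n → ℤ
open LGraph public

record IsSimple {n : ℕ} (G : LGraph n) : Set where
  field
    irrefl    : ∀ u → adj G u u ≡ false
    adj-sym   : ∀ u v → adj G u v ≡ adj G v u
    label-sym : ∀ u v → adj G u v ≡ true → label G u v ≡ label G v u

data Reach {n : ℕ} (G : LGraph n) : Fin n → Fin n → Set where
  here : ∀ {u} → Reach G u u
  step : ∀ {u v w} → adj G u v ≡ true → Reach G v w → Reach G u w

Connected : ∀ {n} → LGraph n → Set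
Connected G = ∀ u v → Reach G u v

IsSpline : ∀ {n} → LGraph n → (Fin n → ℤ) → Set
IsSpline G f =
  (∀ v → mod G v ∣ f v) ×
  (∀ u v → adj G u v ≡ true → label G u v ∣ (f u - f v))

-- j-th flow-up class (F_{j+1} in 1-based numbering of the paper)
IsFlowUp : ∀ {n} → LGraph n → Fin n → (Fin n → ℤ) → Set
IsFlowUp G j f = IsSpline G f × (f j ≢ 0ℤ) × (∀ s → toℕ s < toℕ j → f s ≡ 0ℤ)

-- Reduced graph associated to the last vertex v (= fromℕ n):
-- vertex reduction followed by multiple-edge reduction.
reduce : ∀ {n} → LGraph (suc n) → LGraph n
reduce {n} G = record { adj = adj' ; label = label' ; mod = mod' }
  where
  v : Fin (suc n)
  v = fromℕ n
  old : Fin n → Fin n → Bool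
  old w w' = adj G (inject₁ w) (inject₁ w')
  new : Fin n → Fin n → Bool
  new w w' = adj G v (inject₁ w) ∧ adj G v (inject₁ w') ∧ not ⌊ w ≟ w' ⌋
  newLabel : Fin n → Fin n → ℤ
  newLabel w w' = gcd (label G v (inject₁ w)) (label G v (inject₁ w'))
  adj' : Fin n → Fin n → Bool
  adj' w w' = old w w' ∨ new w w'
  label' : Fin n → Fin n → ℤ
  label' w w' with old w w' | new w w'
  ... | true  | true  = lcm (label G (inject₁ w) (inject₁ w')) (newLabel w w')
  ... | true  | false = label G (inject₁ w) (inject₁ w')
  ... | false | _     = newLabel w w'
  mod' : Fin n → ℤ
  mod' w = if adj G v (inject₁ w)
           then lcm (mod G (inject₁ w)) (gcd (mod G v) (label G v (inject₁ w)))
           else mod G (inject₁ w)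

reduceMany : ∀ {i} k → LGraph (k Data.Nat.+ i) → LGraph i
reduceMany zero    G = G
reduceMany (suc k) G = reduceMany k (reduce G)

low : ∀ {i} k → Fin i → Fin (k Data.Nat.+ i)
low zero    x = x
low (suc k) x = inject₁ (low k x)

ψ : ∀ {i} k → (Fin (k Data.Nat.+ i) → ℤ) → (Fin i → ℤ)
ψ k f x = f (low k x)

-- ψ is restriction to v₁ … vᵢ, so it is ℤ-linear and its kernel consists of the splines vanishing
-- on v₁ … vᵢ: zero and the flow-up classes F_j with j > i. One reduction step at a time, the
-- restriction of a spline f is a spline on the reduced graph because gcd(m_v, r_vw) and
-- gcd(r_vw, r_vw′) divide f_w and f_w − f_w′ through f_v. Conversely a spline g on the reduced graph
-- extends to the deleted vertex v iff some x satisfies x ≡ 0 (mod m_v) and x ≡ g_w (mod r_vw) for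
-- all neighbours w; the new vertex modules and edge labels say exactly that these congruences are
-- pairwise compatible, and over ℤ pairwise compatible congruences are simultaneously solvable
-- (Chinese remainder theorem for arbitrary moduli, from Bézout's identity and the distributivity
-- of the lattice of ideals of ℤ).

module Submission where

open import Defs
open import Data.Nat using (ℕ; zero; suc; _≤_; _<_; _≤?_)
import Data.Nat as ℕ
open import Data.Nat.Properties using (≰⇒>; <-≤-trans)
open import Data.Nat.GCD using (module Bézout; gcd-GCD)
open import Data.Integer using (ℤ; +_; _+_; _*_; _-_; -_; 0ℤ; 1ℤ; ∣_∣)
import Data.Integer.Properties as ℤₚ
open import Data.Integer.Properties
  using (pos-+; pos-*; *-cancelʳ-≡; *-identityʳ; +-identityʳ; +-inverseʳ)
open import Data.Integer.Base using (≢-nonZero)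
open import Data.Integer.Divisibility.Signed
  using (_∣_; divides; ∣ᵤ⇒∣; ∣⇒∣ᵤ; m∣∣m∣; ∣n⇒∣m*n; ∣-refl; ∣-trans; ∣m∣n⇒∣m-n; ∣m⇒∣-m)
open import Data.Integer.GCD using (gcd; gcd[i,j]∣i; gcd[i,j]∣j; gcd[i,j]≡0⇒j≡0; gcd-comm)
open import Data.Integer.LCM using (lcm; lcm-least; i∣lcm[i,j]; j∣lcm[i,j])
open import Data.Integer.Tactic.RingSolver using (solve-∀)
open import Data.Fin using (Fin; zero; suc; toℕ; inject₁; fromℕ; fromℕ<; inject; _≟_)
open import Data.Fin.Properties
  using (toℕ-injective; toℕ-inject₁; toℕ-inject; toℕ-fromℕ<; toℕ<n; all?; ¬∀⟶∃¬-smallest)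
open import Data.Fin.Relation.Unary.Top using (view; view-inject₁; ‵fromℕ; ‵inject₁)
open import Data.Vec.Functional using (_∷_)
open import Data.Bool using (Bool; true; false; _∧_; _∨_; not; if_then_else_)
open import Data.Product using (Σ; ∃; ∃₂; _×_; _,_; proj₁; proj₂)
open import Data.Sum using (_⊎_; inj₁; inj₂)
open import Function using (_∘_)
open import Relation.Nullary using (¬_; yes; no; contradiction)
open import Relation.Nullary.Decidable using (⌊_⌋)
open import Relation.Unary using (Pred; Decidable)
open import Relation.Binary.PropositionalEquality

-- Defs uses the unsigned divisibility of Data.Integer.Divisibility; the development uses the signed
-- one, which carries the arithmetic lemmas, converting with ∣ᵤ⇒∣ and ∣⇒∣ᵤ.

gcd∣ˡ : ∀ a b → gcd a b ∣ a
gcd∣ˡ a b = ∣ᵤ⇒∣ (gcd[i,j]∣i a b)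

gcd∣ʳ : ∀ a b → gcd a b ∣ b
gcd∣ʳ a b = ∣ᵤ⇒∣ (gcd[i,j]∣j a b)

∣lcmˡ : ∀ a b → a ∣ lcm a b
∣lcmˡ a b = ∣ᵤ⇒∣ (i∣lcm[i,j] a b)

∣lcmʳ : ∀ a b → b ∣ lcm a b
∣lcmʳ a b = ∣ᵤ⇒∣ (j∣lcm[i,j] a b)

lcm∣ : ∀ {a b c} → a ∣ c → b ∣ c → lcm a b ∣ c
lcm∣ {a} {b} {c} a∣c b∣c = ∣ᵤ⇒∣ (lcm-least {a} {b} {c} (∣⇒∣ᵤ a∣c) (∣⇒∣ᵤ b∣c))

∣m∣m-n⇒∣n : ∀ {d m n} → d ∣ m → d ∣ m - n → d ∣ n
∣m∣m-n⇒∣n {d} {m} {n} p q = subst (d ∣_) (lemma m n) (∣m∣n⇒∣m-n p q)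
  where
  lemma : ∀ m n → m - (m - n) ≡ n
  lemma = solve-∀

∣m-n∣m-o⇒∣o-n : ∀ {d m n o} → d ∣ m - n → d ∣ m - o → d ∣ o - n
∣m-n∣m-o⇒∣o-n {d} {m} {n} {o} p q = subst (d ∣_) (lemma m n o) (∣m∣n⇒∣m-n p q)
  where
  lemma : ∀ m n o → m - n - (m - o) ≡ o - n
  lemma = solve-∀

∣m-n⇒∣n-m : ∀ {d m n} → d ∣ m - n → d ∣ n - m
∣m-n⇒∣n-m {d} {m} {n} p = subst (d ∣_) (lemma m n) (∣m⇒∣-m p)
  where
  lemma : ∀ m n → - (m - n) ≡ n - m
  lemma = solve-∀

1∣ : ∀ z → 1ℤ ∣ z
1∣ z = divides z (sym (*-identityʳ z))

∣0 : ∀ d → d ∣ 0ℤ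
∣0 d = divides 0ℤ refl

-- Bézout's identity and the Chinese remainder theorem over ℤ

Combination : ℤ → ℤ → ℤ → Set
Combination a b z = ∃₂ λ s t → z ≡ s * a + t * b

pos-identity⇒difference : ∀ {d q s} p r → d ℕ.+ p ℕ.* q ≡ r ℕ.* s → + d ≡ + r * + s - + p * + q
pos-identity⇒difference {d} {q} {s} p r eq = begin
  + d                         ≡⟨ lemma (+ d) (+ p * + q) ⟩
  + d + + p * + q - + p * + q ≡⟨ cong (_- + p * + q) lift ⟩
  + r * + s - + p * + q       ∎
  where
  open ≡-Reasoning
  lemma : ∀ d e → d ≡ d + e - e
  lemma = solve-∀
  lift : + d + + p * + q ≡ + r * + s
  lift = begin
    + d + + p * + q     ≡⟨ cong (_+_ (+ d)) (sym (pos-* p q)) ⟩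
    + d + + (p ℕ.* q)   ≡⟨ sym (pos-+ d (p ℕ.* q)) ⟩
    + (d ℕ.+ p ℕ.* q)   ≡⟨ cong +_ eq ⟩
    + (r ℕ.* s)         ≡⟨ pos-* r s ⟩
    + r * + s           ∎

module _ {a b : ℤ} where

  combination-+ : ∀ {z w} → Combination a b z → Combination a b w → Combination a b (z + w)
  combination-+ (s , t , refl) (s′ , t′ , refl) = s + s′ , t + t′ , lemma a b s t s′ t′
    where
    lemma : ∀ a b s t s′ t′ → s * a + t * b + (s′ * a + t′ * b) ≡ (s + s′) * a + (t + t′) * b
    lemma = solve-∀

  combination-* : ∀ c {z} → Combination a b z → Combination a b (c * z)
  combination-* c (s , t , refl) = c * s , c * t , lemma a b c s t
    where
    lemma : ∀ a b c s t → c * (s * a + t * b) ≡ c * s * a + c * t * b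
    lemma = solve-∀

  combination-- : ∀ {z w} → Combination a b z → Combination a b w → Combination a b (z - w)
  combination-- {z} {w} p q =
    subst (Combination a b) (lemma z w) (combination-+ p (combination-* (- 1ℤ) q))
    where
    lemma : ∀ z w → z + - 1ℤ * w ≡ z - w
    lemma = solve-∀

  ∣⇒combinationˡ : ∀ {z} → a ∣ z → Combination a b z
  ∣⇒combinationˡ (divides q refl) = q , 0ℤ , lemma a b q
    where
    lemma : ∀ a b q → q * a ≡ q * a + 0ℤ * b
    lemma = solve-∀

  ∣⇒combinationʳ : ∀ {z} → b ∣ z → Combination a b z
  ∣⇒combinationʳ (divides q refl) = 0ℤ , q , lemma a b q
    where
    lemma : ∀ a b q → q * b ≡ 0ℤ * a + q * b
    lemma = solve-∀

  combination-gcd : Combination a b (gcd a b)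
  combination-gcd with Bézout.identity (gcd-GCD ∣ a ∣ ∣ b ∣)
  ... | Bézout.+- x y eq = subst (Combination a b) (sym (pos-identity⇒difference y x eq))
          (combination-- (∣⇒combinationˡ (∣n⇒∣m*n (+ x) m∣∣m∣)) (∣⇒combinationʳ (∣n⇒∣m*n (+ y) m∣∣m∣)))
  ... | Bézout.-+ x y eq = subst (Combination a b) (sym (pos-identity⇒difference x y eq))
          (combination-- (∣⇒combinationʳ (∣n⇒∣m*n (+ y) m∣∣m∣)) (∣⇒combinationˡ (∣n⇒∣m*n (+ x) m∣∣m∣)))

  gcd∣⇒combination : ∀ {z} → gcd a b ∣ z → Combination a b z
  gcd∣⇒combination (divides q refl) = combination-* q combination-gcd

-- Distributivity of the ideal lattice of ℤ: ((a) + (c)) ∩ ((b) + (c)) ⊆ ((a) ∩ (b)) + (c).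
combination-lcm : ∀ a b → ∃ λ l → (a ∣ l) × (b ∣ l) ×
                  (∀ {c z} → Combination a c z → Combination b c z → Combination l c z)
combination-lcm a b with gcd a b ℤₚ.≟ 0ℤ
... | yes g≡0 = 0ℤ , ∣0 a , ∣0 b ,
                λ _ → subst (λ b → Combination b _ _) (gcd[i,j]≡0⇒j≡0 {a} g≡0)
... | no g≢0 with gcd∣ˡ a b | gcd∣ʳ a b | combination-gcd {a} {b}
... | divides a′ a≡a′g | divides b′ b≡b′g | u , v , g≡ua+vb =
  a′ * b , divides b′ (cross-multiply a′ b′ a≡a′g b≡b′g) , ∣n⇒∣m*n a′ ∣-refl , least
  where
  g = gcd a b
  cross-multiply : ∀ a′ b′ {a b g : ℤ} → a ≡ a′ * g → b ≡ b′ * g → a′ * b ≡ b′ * a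
  cross-multiply a′ b′ {g = g} refl refl = lemma a′ b′ g
    where
    lemma : ∀ a′ b′ g → a′ * (b′ * g) ≡ b′ * (a′ * g)
    lemma = solve-∀
  -- Write g z = u a z + v b z and expand each z through the other generator: everything is a
  -- multiple of g (a′ b) or of g c, and g cancels.
  least : ∀ {c z} → Combination a c z → Combination b c z → Combination (a′ * b) c z
  least {c} {z} (α , p , z≡αa+pc) (β , q , z≡βb+qc) =
    u * β + v * α , u * a′ * q + v * b′ * p ,
    *-cancelʳ-≡ z _ g {{≢-nonZero g≢0}} (begin
      z * g                                             ≡⟨ cong (z *_) g≡ua+vb ⟩
      z * (u * a + v * b)                               ≡⟨ distrib z u v a b ⟩
      u * a * z + v * b * z                             ≡⟨ cong₂ (λ x y → u * a * x + v * b * y)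
                                                                z≡βb+qc z≡αa+pc ⟩
      u * a * (β * b + q * c) + v * b * (α * a + p * c) ≡⟨ expand a≡a′g b≡b′g ⟩
      ((u * β + v * α) * (a′ * b) + (u * a′ * q + v * b′ * p) * c) * g ∎)
    where
    open ≡-Reasoning
    distrib : ∀ z u v a b → z * (u * a + v * b) ≡ u * a * z + v * b * z
    distrib = solve-∀
    expand : ∀ {a b} → a ≡ a′ * g → b ≡ b′ * g →
             u * a * (β * b + q * c) + v * b * (α * a + p * c) ≡
             ((u * β + v * α) * (a′ * b) + (u * a′ * q + v * b′ * p) * c) * g
    expand refl refl = lemma u v α β p q a′ b′ c g
      where
      lemma : ∀ u v α β p q a′ b′ c g →
              u * (a′ * g) * (β * (b′ * g) + q * c) + v * (b′ * g) * (α * (a′ * g) + p * c) ≡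
              ((u * β + v * α) * (a′ * (b′ * g)) + (u * a′ * q + v * b′ * p) * c) * g
      lemma = solve-∀

record CRTSolution {n} (m a : Fin n → ℤ) : Set where
  field
    solution            : ℤ
    modulus             : ℤ
    solves              : ∀ j → m j ∣ solution - a j
    m∣modulus           : ∀ j → m j ∣ modulus
    -- (modulus) + (c) ⊇ ⋂ⱼ ((m j) + (c)): what crt-step needs to add one more congruence.
    modulus-combination : ∀ {c z} → (∀ j → Combination (m j) c z) → Combination modulus c z

modulus-compatible : ∀ {n} {m a : Fin n → ℤ} (S : CRTSolution m a) {m₀ a₀} →
                     (∀ j → gcd (m j) m₀ ∣ a j - a₀) →
                     Combination (CRTSolution.modulus S) m₀ (CRTSolution.solution S - a₀)
modulus-compatible {a = a} S {a₀ = a₀} compatible = modulus-combination λ j →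
  subst (Combination _ _) (telescope solution (a j) a₀)
    (combination-+ (∣⇒combinationˡ (solves j)) (gcd∣⇒combination (compatible j)))
  where
  open CRTSolution S
  telescope : ∀ x y z → x - y + (y - z) ≡ x - z
  telescope = solve-∀

crt-step : ∀ {n} {m a : Fin (suc n) → ℤ} → CRTSolution (m ∘ suc) (a ∘ suc) →
           (∀ j → gcd (m (suc j)) (m zero) ∣ a (suc j) - a zero) → CRTSolution m a
crt-step {m = m} {a} S compatible
  with combination-lcm (CRTSolution.modulus S) (m zero) | modulus-compatible S compatible
... | l , L∣l , m₀∣l , l-combination | s , t , x-a₀≡sL+tm₀ = record
  { solution            = x - s * L
  ; modulus             = l
  ; solves              = λ { zero    → divides t x-sL-a₀≡tm₀
                            ; (suc j) → subst (m (suc j) ∣_) (swap x (a (suc j)) (s * L))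
                                          (∣m∣n⇒∣m-n (solves j) (∣n⇒∣m*n s (m∣modulus j))) }
  ; m∣modulus           = λ { zero → m₀∣l ; (suc j) → ∣-trans (m∣modulus j) L∣l }
  ; modulus-combination = λ h → l-combination (modulus-combination (h ∘ suc)) (h zero)
  }
  where
  open CRTSolution S renaming (solution to x; modulus to L)
  swap : ∀ x y c → x - y - c ≡ x - c - y
  swap = solve-∀
  x-sL-a₀≡tm₀ : x - s * L - a zero ≡ t * m zero
  x-sL-a₀≡tm₀ = begin
    x - s * L - a zero            ≡⟨ swap x (s * L) (a zero) ⟩
    x - a zero - s * L            ≡⟨ cong (_- s * L) x-a₀≡sL+tm₀ ⟩
    s * L + t * m zero - s * L    ≡⟨ cancel (s * L) (t * m zero) ⟩
    t * m zero                    ∎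
    where
    open ≡-Reasoning
    cancel : ∀ u v → u + v - u ≡ v
    cancel = solve-∀

crt : ∀ {n} (m a : Fin n → ℤ) → (∀ j k → gcd (m j) (m k) ∣ a j - a k) → CRTSolution m a
crt {zero} m a _ = record
  { solution            = 0ℤ
  ; modulus             = 1ℤ
  ; solves              = λ ()
  ; m∣modulus           = λ ()
  ; modulus-combination = λ {_} {z} _ → ∣⇒combinationˡ (1∣ z)
  }
crt {suc n} m a compatible =
  crt-step (crt (m ∘ suc) (a ∘ suc) (λ j k → compatible (suc j) (suc k))) (λ j → compatible (suc j) zero)

-- A single reduction step

_∷ʳ_ : ∀ {a} {A : Set a} {n} → (Fin n → A) → A → Fin (suc n) → A
(g ∷ʳ x) i with view i
... | ‵fromℕ     = x
... | ‵inject₁ j = g j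

∷ʳ-inject₁ : ∀ {a} {A : Set a} {n} (g : Fin n → A) x j → (g ∷ʳ x) (inject₁ j) ≡ g j
∷ʳ-inject₁ g x j rewrite view-inject₁ j = refl

module SplineDivisibility {n} (G : LGraph n) (f : Fin n → ℤ) (spline : IsSpline G f) where

  mod∣ : ∀ v → mod G v ∣ f v
  mod∣ v = ∣ᵤ⇒∣ (proj₁ spline v)

  label∣ : ∀ u v → adj G u v ≡ true → label G u v ∣ f u - f v
  label∣ u v e = ∣ᵤ⇒∣ (proj₂ spline u v e)

mkSpline : ∀ {n} {G : LGraph n} {f} → (∀ v → mod G v ∣ f v) →
           (∀ u v → adj G u v ≡ true → label G u v ∣ f u - f v) → IsSpline G f
mkSpline f-mod f-edge = (λ v → ∣⇒∣ᵤ (f-mod v)) , (λ u v e → ∣⇒∣ᵤ (f-edge u v e))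

module _ {n} (G : LGraph (suc n)) where

  top : Fin (suc n)
  top = fromℕ n

  topLabel : Fin n → ℤ
  topLabel w = label G top (inject₁ w)

  Joined : Fin n → Fin n → Bool
  Joined w w′ = adj G top (inject₁ w) ∧ adj G top (inject₁ w′) ∧ not ⌊ w ≟ w′ ⌋

  joined⇒adj : ∀ {w w′} → Joined w w′ ≡ true →
               adj G top (inject₁ w) ≡ true × adj G top (inject₁ w′) ≡ true
  joined⇒adj {w} {w′} e with adj G top (inject₁ w) | adj G top (inject₁ w′)
  joined⇒adj e | true | true = refl , refl

  adj⇒joined : ∀ {w w′} → adj G top (inject₁ w) ≡ true → adj G top (inject₁ w′) ≡ true → w ≢ w′ →
               Joined w w′ ≡ true
  adj⇒joined {w} {w′} e e′ w≢w′ rewrite e | e′ with w ≟ w′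
  ... | yes w≡w′ = contradiction w≡w′ w≢w′
  ... | no _     = refl

  mod-reduce-∣ : ∀ w {z} → mod G (inject₁ w) ∣ z →
                 (adj G top (inject₁ w) ≡ true → gcd (mod G top) (topLabel w) ∣ z) →
                 mod (reduce G) w ∣ z
  mod-reduce-∣ w hw htop with adj G top (inject₁ w)
  ... | true  = lcm∣ hw (htop refl)
  ... | false = hw

  mod∣mod-reduce : ∀ w → mod G (inject₁ w) ∣ mod (reduce G) w
  mod∣mod-reduce w with adj G top (inject₁ w)
  ... | true  = ∣lcmˡ (mod G (inject₁ w)) (gcd (mod G top) (topLabel w))
  ... | false = ∣-refl

  gcd∣mod-reduce : ∀ w → adj G top (inject₁ w) ≡ true → gcd (mod G top) (topLabel w) ∣ mod (reduce G) w
  gcd∣mod-reduce w e with adj G top (inject₁ w)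
  gcd∣mod-reduce w refl | true = ∣lcmʳ (mod G (inject₁ w)) (gcd (mod G top) (topLabel w))

  adj-reduce-inject₁ : ∀ {w w′} → adj G (inject₁ w) (inject₁ w′) ≡ true → adj (reduce G) w w′ ≡ true
  adj-reduce-inject₁ e rewrite e = refl

  adj-reduce-joined : ∀ {w w′} → Joined w w′ ≡ true → adj (reduce G) w w′ ≡ true
  adj-reduce-joined {w} {w′} e with adj G (inject₁ w) (inject₁ w′)
  ... | true  = refl
  ... | false = e

  label-reduce-∣ : ∀ w w′ {z} → adj (reduce G) w w′ ≡ true →
                   (adj G (inject₁ w) (inject₁ w′) ≡ true → label G (inject₁ w) (inject₁ w′) ∣ z) →
                   (Joined w w′ ≡ true → gcd (topLabel w) (topLabel w′) ∣ z) →
                   label (reduce G) w w′ ∣ z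
  label-reduce-∣ w w′ e hold hnew with adj G (inject₁ w) (inject₁ w′) | Joined w w′
  ... | true  | true  = lcm∣ (hold refl) (hnew refl)
  ... | true  | false = hold refl
  ... | false | true  = hnew refl

  label∣label-reduce : ∀ w w′ → adj G (inject₁ w) (inject₁ w′) ≡ true →
                       label G (inject₁ w) (inject₁ w′) ∣ label (reduce G) w w′
  label∣label-reduce w w′ e with adj G (inject₁ w) (inject₁ w′) | Joined w w′
  label∣label-reduce w w′ refl | true | true  =
    ∣lcmˡ (label G (inject₁ w) (inject₁ w′)) (gcd (topLabel w) (topLabel w′))
  label∣label-reduce w w′ refl | true | false = ∣-refl

  gcd∣label-reduce : ∀ w w′ → Joined w w′ ≡ true → gcd (topLabel w) (topLabel w′) ∣ label (reduce G) w w′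
  gcd∣label-reduce w w′ e with adj G (inject₁ w) (inject₁ w′) | Joined w w′
  gcd∣label-reduce w w′ refl | true  | true =
    ∣lcmʳ (label G (inject₁ w) (inject₁ w′)) (gcd (topLabel w) (topLabel w′))
  gcd∣label-reduce w w′ refl | false | true = ∣-refl

  joined-irrefl : ∀ w → Joined w w ≡ false
  joined-irrefl w with w ≟ w
  ... | no w≢w = contradiction refl w≢w
  ... | yes _ with adj G top (inject₁ w)
  ...   | true  = refl
  ...   | false = refl

  joined-sym : ∀ w w′ → Joined w w′ ≡ Joined w′ w
  joined-sym w w′ with adj G top (inject₁ w) | adj G top (inject₁ w′) | w ≟ w′ | w′ ≟ w
  ... | false | false | _ | _ = refl
  ... | false | true  | _ | _ = refl
  ... | true  | false | _ | _ = refl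
  ... | true  | true  | yes _ | yes _ = refl
  ... | true  | true  | no _  | no _  = refl
  ... | true  | true  | yes w≡w′ | no w′≢w = contradiction (sym w≡w′) w′≢w
  ... | true  | true  | no w≢w′ | yes w′≡w = contradiction (sym w′≡w) w≢w′

  reduce-isSimple : IsSimple G → IsSimple (reduce G)
  reduce-isSimple simple = record
    { irrefl    = λ w → trans (cong (_∨ Joined w w) (irrefl (inject₁ w))) (joined-irrefl w)
    ; adj-sym   = λ w w′ → cong₂ _∨_ (adj-sym (inject₁ w) (inject₁ w′)) (joined-sym w w′)
    ; label-sym = λ w w′ _ → label-reduce-sym w w′
    }
    where
    open IsSimple simple
    label-reduce-sym : ∀ w w′ → label (reduce G) w w′ ≡ label (reduce G) w′ w
    label-reduce-sym w w′ rewrite adj-sym (inject₁ w) (inject₁ w′) | joined-sym w w′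
      with adj G (inject₁ w′) (inject₁ w) in e | Joined w′ w
    ... | true  | true  = cong₂ lcm (label-sym (inject₁ w) (inject₁ w′) (trans (adj-sym _ _) e))
                                    (gcd-comm (topLabel w) (topLabel w′))
    ... | true  | false = label-sym (inject₁ w) (inject₁ w′) (trans (adj-sym _ _) e)
    ... | false | _     = gcd-comm (topLabel w) (topLabel w′)

  restrict-reduce : ∀ f → IsSpline G f → IsSpline (reduce G) (f ∘ inject₁)
  restrict-reduce f spline = mkSpline g-mod g-edge
    where
    open SplineDivisibility G f spline
    g-mod : ∀ w → mod (reduce G) w ∣ f (inject₁ w)
    g-mod w = mod-reduce-∣ w (mod∣ (inject₁ w)) λ e →
      ∣m∣m-n⇒∣n (∣-trans (gcd∣ˡ (mod G top) (topLabel w)) (mod∣ top))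
                (∣-trans (gcd∣ʳ (mod G top) (topLabel w)) (label∣ top (inject₁ w) e))
    g-edge : ∀ w w′ → adj (reduce G) w w′ ≡ true → label (reduce G) w w′ ∣ f (inject₁ w) - f (inject₁ w′)
    g-edge w w′ e = label-reduce-∣ w w′ e (label∣ (inject₁ w) (inject₁ w′)) λ j →
      ∣m-n∣m-o⇒∣o-n {m = f top}
        (∣-trans (gcd∣ʳ (topLabel w) (topLabel w′)) (label∣ top (inject₁ w′) (proj₂ (joined⇒adj j))))
        (∣-trans (gcd∣ˡ (topLabel w) (topLabel w′)) (label∣ top (inject₁ w) (proj₁ (joined⇒adj j))))

  extend-reduce : IsSimple G → ∀ g → IsSpline (reduce G) g →
                  ∃ λ f → IsSpline G f × (∀ w → f (inject₁ w) ≡ g w)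
  extend-reduce simple g spline = g ∷ʳ x , mkSpline f-mod f-edge , ∷ʳ-inject₁ g x
    where
    open IsSimple simple
    open SplineDivisibility (reduce G) g spline
    -- Non-neighbours of top impose no congruence on x, hence modulus 1.
    ρ : Fin n → ℤ
    ρ w = if adj G top (inject₁ w) then topLabel w else 1ℤ
    ρ-compatible : ∀ w w′ → gcd (ρ w) (ρ w′) ∣ g w - g w′
    ρ-compatible w w′ with adj G top (inject₁ w) in e
    ... | false = ∣-trans (gcd∣ˡ 1ℤ (ρ w′)) (1∣ _)
    ... | true  with adj G top (inject₁ w′) in e′
    ...   | false = ∣-trans (gcd∣ʳ (topLabel w) 1ℤ) (1∣ _)
    ...   | true  with w ≟ w′
    ...     | yes refl = subst (_ ∣_) (sym (+-inverseʳ (g w))) (∣0 _)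
    ...     | no w≢w′  = ∣-trans (gcd∣label-reduce w w′ joined) (label∣ w w′ (adj-reduce-joined joined))
      where
      joined = adj⇒joined e e′ w≢w′
    top-compatible : ∀ w → gcd (ρ w) (mod G top) ∣ g w - 0ℤ
    top-compatible w = subst (gcd (ρ w) (mod G top) ∣_) (sym (+-identityʳ (g w))) (ρ-mod w)
      where
      ρ-mod : ∀ w → gcd (ρ w) (mod G top) ∣ g w
      ρ-mod w with adj G top (inject₁ w) in e
      ... | false = ∣-trans (gcd∣ˡ 1ℤ (mod G top)) (1∣ _)
      ... | true  = subst (_∣ g w) (gcd-comm (mod G top) (topLabel w))
                      (∣-trans (gcd∣mod-reduce w e) (mod∣ w))
    open CRTSolution (crt-step {m = mod G top ∷ ρ} {a = 0ℤ ∷ g} (crt ρ g ρ-compatible) top-compatible)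
      renaming (solution to x)
    x-mod : mod G top ∣ x
    x-mod = subst (mod G top ∣_) (+-identityʳ x) (solves zero)
    x-topLabel : ∀ w → adj G top (inject₁ w) ≡ true → topLabel w ∣ x - g w
    x-topLabel w e = subst (λ b → (if b then topLabel w else 1ℤ) ∣ x - g w) e (solves (suc w))
    f-mod : ∀ u → mod G u ∣ (g ∷ʳ x) u
    f-mod u with view u
    ... | ‵fromℕ     = x-mod
    ... | ‵inject₁ w = ∣-trans (mod∣mod-reduce w) (mod∣ w)
    f-edge : ∀ u u′ → adj G u u′ ≡ true → label G u u′ ∣ (g ∷ʳ x) u - (g ∷ʳ x) u′
    f-edge u u′ e with view u | view u′
    ... | ‵fromℕ | ‵fromℕ = contradiction (trans (sym e) (irrefl top)) λ ()
    ... | ‵fromℕ | ‵inject₁ w′ = x-topLabel w′ e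
    ... | ‵inject₁ w | ‵fromℕ =
      subst (_∣ g w - x) (sym (label-sym (inject₁ w) top e))
        (∣m-n⇒∣n-m {m = x} (x-topLabel w (trans (adj-sym top (inject₁ w)) e)))
    ... | ‵inject₁ w | ‵inject₁ w′ =
      ∣-trans (label∣label-reduce w w′ e) (label∣ w w′ (adj-reduce-inject₁ e))

-- Iterated reduction and the kernel of ψ

restrict-reduceMany : ∀ {i} k (G : LGraph (k ℕ.+ i)) f → IsSpline G f → IsSpline (reduceMany k G) (ψ k f)
restrict-reduceMany zero    G f spline = spline
restrict-reduceMany (suc k) G f spline =
  restrict-reduceMany k (reduce G) (f ∘ inject₁) (restrict-reduce G f spline)

extend-reduceMany : ∀ {i} k (G : LGraph (k ℕ.+ i)) → IsSimple G → ∀ g → IsSpline (reduceMany k G) g →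
                    ∃ λ f → IsSpline G f × (∀ x → ψ k f x ≡ g x)
extend-reduceMany zero    G simple g spline = g , spline , λ _ → refl
extend-reduceMany (suc k) G simple g spline
  with extend-reduceMany k (reduce G) (reduce-isSimple G simple) g spline
... | f′ , f′-spline , ψf′≡g with extend-reduce G simple f′ f′-spline
... | f , f-spline , f∘inject₁≡f′ = f , f-spline , λ x → trans (f∘inject₁≡f′ (low k x)) (ψf′≡g x)

all⊎∃¬-smallest : ∀ {n p} {P : Pred (Fin n) p} → Decidable P →
                  (∀ i → P i) ⊎ ∃ λ j → ¬ P j × (∀ i → toℕ i < toℕ j → P i)
all⊎∃¬-smallest {P = P} P? with all? P?
... | yes ∀P = inj₁ ∀P
... | no ¬∀P with ¬∀⟶∃¬-smallest _ P P? ¬∀P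
... | j , ¬Pj , below = inj₂ (j , ¬Pj , λ i i<j → subst P (inject-fromℕ< i<j) (below (fromℕ< i<j)))
  where
  inject-fromℕ< : ∀ {i} (i<j : toℕ i < toℕ j) → inject (fromℕ< i<j) ≡ i
  inject-fromℕ< i<j = toℕ-injective (trans (toℕ-inject (fromℕ< i<j)) (toℕ-fromℕ< i<j))

toℕ-low : ∀ {i} k (x : Fin i) → toℕ (low k x) ≡ toℕ x
toℕ-low zero    x = refl
toℕ-low (suc k) x = trans (toℕ-inject₁ (low k x)) (toℕ-low k x)

low-fromℕ< : ∀ {i} k {j : Fin (k ℕ.+ i)} (j<i : toℕ j < i) → low k (fromℕ< j<i) ≡ j
low-fromℕ< k j<i = toℕ-injective (trans (toℕ-low k (fromℕ< j<i)) (toℕ-fromℕ< j<i))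

module _ {i} k (G : LGraph (k ℕ.+ i)) (f : Fin (k ℕ.+ i) → ℤ) where

  ψ≡0⇒flowUp : IsSpline G f → (∀ x → ψ k f x ≡ 0ℤ) →
               (∃ λ j → (i ≤ toℕ j) × IsFlowUp G j f) ⊎ (∀ v → f v ≡ 0ℤ)
  ψ≡0⇒flowUp spline ψf≡0 with all⊎∃¬-smallest (λ v → f v ℤₚ.≟ 0ℤ)
  ... | inj₁ f≡0 = inj₂ f≡0
  ... | inj₂ (j , fj≢0 , below) with i ≤? toℕ j
  ...   | yes i≤j = inj₁ (j , i≤j , spline , fj≢0 , below)
  ...   | no  i≰j = contradiction (subst (λ v → f v ≡ 0ℤ) (low-fromℕ< k j<i) (ψf≡0 (fromℕ< j<i))) fj≢0
    where
    j<i = ≰⇒> i≰j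

  flowUp⇒ψ≡0 : (∃ λ j → (i ≤ toℕ j) × IsFlowUp G j f) ⊎ (∀ v → f v ≡ 0ℤ) → ∀ x → ψ k f x ≡ 0ℤ
  flowUp⇒ψ≡0 (inj₁ (j , i≤j , _ , _ , below)) x =
    below (low k x) (subst (_< toℕ j) (sym (toℕ-low k x)) (<-≤-trans (toℕ<n x) i≤j))
  flowUp⇒ψ≡0 (inj₂ f≡0) x = f≡0 (low k x)

-- ψ k f is f ∘ low k, so ψ is linear by definition.
corollary4p5 : (i k : ℕ) (G : LGraph (k Data.Nat.+ i)) →
    IsSimple G → Connected G →
    ((f g : Fin (k Data.Nat.+ i) → ℤ) → ∀ x → ψ k (λ v → f v + g v) x ≡ ψ k f x + ψ k g x) ×
    ((c : ℤ) (f : Fin (k Data.Nat.+ i) → ℤ) → ∀ x → ψ k (λ v → c * f v) x ≡ c * ψ k f x) ×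
    ((f : Fin (k Data.Nat.+ i) → ℤ) → IsSpline G f → IsSpline (reduceMany k G) (ψ k f)) ×
    ((g : Fin i → ℤ) → IsSpline (reduceMany k G) g →
      Σ (Fin (k Data.Nat.+ i) → ℤ) (λ f → IsSpline G f × (∀ x → ψ k f x ≡ g x))) ×
    ((f : Fin (k Data.Nat.+ i) → ℤ) → IsSpline G f →
      ((∀ x → ψ k f x ≡ 0ℤ) →
        (Σ (Fin (k Data.Nat.+ i)) (λ j → (i ≤ toℕ j) × IsFlowUp G j f)) ⊎ (∀ v → f v ≡ 0ℤ)) ×
      ((Σ (Fin (k Data.Nat.+ i)) (λ j → (i ≤ toℕ j) × IsFlowUp G j f)) ⊎ (∀ v → f v ≡ 0ℤ) →
        ∀ x → ψ k f x ≡ 0ℤ))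
corollary4p5 i k G simple _ =
  (λ _ _ _ → refl) ,
  (λ _ _ _ → refl) ,
  restrict-reduceMany k G ,
  extend-reduceMany k G simple ,
  λ f spline → ψ≡0⇒flowUp k G f spline , flowUp⇒ψ≡0 k G f
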